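{- Let $H$ be a finite simple graph with at least one edge and no isolated edges, and let $k_0,k_1,k_0',k_1'$ be as defined in the context. Then there is a constant $c$ (depending on $H$) such that for every integer $n \geq |H|$, \[ \operatorname{sat}(n,H) \geq \left( k_0 + \frac{k_1' - k_0}{k_1' + 1} \right) \frac{n}{2} - c. \] Further, if in addition $k_1 > k_0$, then $\operatorname{sat}(n,H) \geq \big( k_0 + (k_1' - k_0) / k_1' \big) n / 2 - c$, and if $k_0 = k_1 < k_1' < k_0'$, then \[ \operatorname{sat}(n,H) \geq \begin{cases} \big( k_0 + \frac{k_0' - k_0}{k_0' + 1} \big) \frac{n}{2} - c & \text{if } k_0' \leq k_1' + \frac{k_0' - k_0}{k_0 + 1} ; \\ \big( k_0 + \frac{k_1' - k_0}{k_1'} \big) \frac{n}{2} - c & \text{otherwise.} \end{cases} \]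
   Context: Graphs are finite and simple; $|G|$ denotes the number of vertices. A graph $G$ is $H$-saturated if $G$ contains no subgraph isomorphic to $H$ but adding any edge joining two nonadjacent vertices of $G$ creates such a subgraph. $\operatorname{sat}(n,H)$ is the minimum number of edges of an $H$-saturated graph on $n$ vertices. For an edge $uv$ of $H$, let $N(uv) = (N(u)\setminus\{v\}) \cup (N(v)\setminus\{u\})$; the edge is isolated if $N(uv)=\varnothing$. Degrees are taken in $H$. Define $\mathrm{wt}_0(uv) = \max\{d(u),d(v)\} - 1$ and, for non-isolated $uv$, $\mathrm{wt}_1(uv) = \max_{w \in N(uv)} d(w)$. Let $k_0 = \min_{uv\in E(H)} \mathrm{wt}_0(uv)$, $k_1 = \min_{uv \in E(H)} \mathrm{wt}_1(uv)$, $k_0' = \min\{\mathrm{wt}_0(uv) : uv \in E(H),\ \mathrm{wt}_1(uv) = k_1\}$, and $k_1' = \min\{\mathrm{wt}_1(uv) : uv \in E(H),\ \mathrm{wt}_0(uv) = k_0\}$. -}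

module Defs where

open import Data.Bool using (Bool; true; false; _∧_; _∨_; not; if_then_else_)
open import Data.Nat using (ℕ; zero; suc; _+_; _*_; _∸_; _⊓_; _⊔_; _<ᵇ_; _≤_; _<_)
open import Data.Fin using (Fin; toℕ)
open import Data.Fin.Properties using (_≟_)
open import Data.List using (List; []; _∷_; map; filter; length; allFin; foldr; concatMap)
open import Data.Product using (_×_; _,_; proj₁; proj₂; ∃-syntax; Σ-syntax)
open import Data.Integer using (ℤ; +_; _-_) renaming (_*_ to _*ℤ_; _+_ to _+ℤ_; _≤_ to _≤ℤ_)
open import Relation.Binary.PropositionalEquality using (_≡_; _≢_)
open import Relation.Nullary using (¬_; ⌊_⌋)
open import Function.Definitions using (Injective)

record Graph (n : ℕ) : Set where
  field
    adj    : Fin n → Fin n → Bool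
    sym    : ∀ i j → adj i j ≡ adj j i
    irrefl : ∀ i → adj i i ≡ false
open Graph public

order : ∀ {n} → Graph n → ℕ
order {n} _ = n

countL : ∀ {A : Set} → (A → Bool) → List A → ℕ
countL p xs = length (filter (λ x → p x Data.Bool.≟ true) xs)

deg : ∀ {n} → Graph n → Fin n → ℕ
deg G v = countL (adj G v) (allFin _)

pairs : ∀ n → List (Fin n × Fin n)
pairs n = concatMap (λ i → map (λ j → (i , j)) (allFin n)) (allFin n)

edgeCount : ∀ {n} → Graph n → ℕ
edgeCount {n} G = countL (λ p → (toℕ (proj₁ p) <ᵇ toℕ (proj₂ p)) ∧ adj G (proj₁ p) (proj₂ p)) (pairs n)

ContainsCopy : ∀ {m n} → Graph m → (Fin n → Fin n → Bool) → Set
ContainsCopy {m} {n} H A =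
  Σ[ f ∈ (Fin m → Fin n) ] Injective _≡_ _≡_ f ×
    (∀ i j → adj H i j ≡ true → A (f i) (f j) ≡ true)

addEdge : ∀ {n} → Graph n → Fin n → Fin n → (Fin n → Fin n → Bool)
addEdge G x y a b =
  adj G a b ∨ ((⌊ a ≟ x ⌋ ∧ ⌊ b ≟ y ⌋) ∨ (⌊ a ≟ y ⌋ ∧ ⌊ b ≟ x ⌋))

Saturated : ∀ {m n} → Graph m → Graph n → Set
Saturated H G =
  ¬ ContainsCopy H (adj G) ×
  (∀ x y → x ≢ y → adj G x y ≡ false → ContainsCopy H (addEdge G x y))

edgesL : ∀ {m} → Graph m → List (Fin m × Fin m)
edgesL {m} H = filter (λ p → adj H (proj₁ p) (proj₂ p) Data.Bool.≟ true) (pairs m)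

IsEdge : ∀ {m} → Graph m → Fin m → Fin m → Set
IsEdge H u v = adj H u v ≡ true

inNbhd : ∀ {m} → Graph m → Fin m → Fin m → Fin m → Bool
inNbhd H u v w =
  (adj H u w ∧ not ⌊ w ≟ v ⌋) ∨ (adj H v w ∧ not ⌊ w ≟ u ⌋)

IsolatedEdge : ∀ {m} → Graph m → Fin m → Fin m → Set
IsolatedEdge H u v = ∀ w → inNbhd H u v w ≡ false

HasEdge : ∀ {m} → Graph m → Set
HasEdge H = ∃[ u ] ∃[ v ] IsEdge H u v

NoIsolatedEdges : ∀ {m} → Graph m → Set
NoIsolatedEdges H = ∀ u v → IsEdge H u v → ¬ IsolatedEdge H u v

maxL : List ℕ → ℕ
maxL = foldr _⊔_ 0

-- minimum of a list (0 on the empty list; only used on nonempty lists)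
minL : List ℕ → ℕ
minL []           = 0
minL (x ∷ [])     = x
minL (x ∷ y ∷ ys) = x ⊓ minL (y ∷ ys)

wt0 : ∀ {m} → Graph m → Fin m × Fin m → ℕ
wt0 H (u , v) = (deg H u ⊔ deg H v) ∸ 1

-- wt₁(uv) = max_{w ∈ N(uv)} d(w)   (meaningful for non-isolated uv)
wt1 : ∀ {m} → Graph m → Fin m × Fin m → ℕ
wt1 {m} H (u , v) = maxL (map (deg H) (filter (λ w → inNbhd H u v w Data.Bool.≟ true) (allFin m)))

k0 : ∀ {m} → Graph m → ℕ
k0 H = minL (map (wt0 H) (edgesL H))

k1 : ∀ {m} → Graph m → ℕ
k1 H = minL (map (wt1 H) (edgesL H))

k0′ : ∀ {m} → Graph m → ℕ
k0′ H = minL (map (wt0 H) (filter (λ e → wt1 H e Data.Nat.≟ k1 H) (edgesL H)))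

k1′ : ∀ {m} → Graph m → ℕ
k1′ H = minL (map (wt1 H) (filter (λ e → wt0 H e Data.Nat.≟ k0 H) (edgesL H)))

-- Lower bound "e ≥ (a + b / D) · n / 2 - c" with D > 0, a, b, D integers,
-- written with the denominator 2·D cleared:  (a·D + b)·n ≤ 2·D·(e + c).

LowerBound : (a b : ℤ) (D : ℕ) (n e c : ℕ) → Set
LowerBound a b D n e c =
  ((a *ℤ + D) +ℤ b) *ℤ + n ≤ℤ + (2 * D * (e + c))

{-# OPTIONS --safe #-}
module Submission where

-- Discharging. Give every vertex v of an H-saturated graph G the charge D·d(v), so that the total
-- is 2D·e(G), and let every vertex of degree ≥ k₁′ send b to each neighbour of degree ≤ k₀. If
-- xy is a non-edge, G + xy contains a copy of H through xy, the image of an edge uv of H; then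
-- d(u) ≤ d(x) + 1, d(v) ≤ d(y) + 1, and every w ∈ N(uv) lands on a neighbour of x or y of degree
-- ≥ d(w). Comparing with the minimality defining k₀, k₁, k₀′, k₁′ shows that the vertices that
-- could end with less than k₀D + b form two cliques of degree ≤ k₀ plus at most one further
-- vertex. Hence n(k₀D + b) ≤ 2D·e(G) + O(1), and the four bounds come from
-- (D, b) = (k₁′ + 1, k₁′ − k₀), (k₁′, k₁′ − k₀), (k₀′ + 1, k₀′ − k₀) and (k₁′, k₁′ − k₀).

open import Defs renaming (sym to adj-sym; irrefl to adj-irrefl)
open import Data.Bool as Bool using (Bool; true; false; T; _∧_; if_then_else_)
open import Data.Bool.Properties using (¬-not)
open import Data.Fin using (Fin; toℕ; zero; suc)
open import Data.Fin.Properties using (_≟_; any?; all?; ¬∀⟶∃¬; toℕ-injective)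
import Data.Fin.Properties as Finₚ
open import Data.List using (List; []; _∷_; _++_; map; filter; length; allFin; tabulate; concatMap)
open import Data.List.Properties using (length-++; filter-++; map-tabulate)
open import Data.List.Membership.Propositional using (_∈_)
open import Data.List.Membership.Propositional.Properties
  using (∈-map⁺; ∈-map⁻; ∈-filter⁺; ∈-filter⁻; ∈-allFin; ∈-concat⁺′)
open import Data.List.Relation.Unary.All using (All; []; _∷_; lookupAny)
import Data.List.Relation.Unary.All as All
open import Data.List.Relation.Unary.All.Properties using (all-filter)
import Data.List.Relation.Unary.All.Properties as Allₚ
open import Data.List.Relation.Unary.Any using (Any; here; there)
import Data.List.Relation.Unary.Any as Any
import Data.List.Relation.Unary.Any.Properties as Anyₚ
open import Data.Nat using (ℕ; zero; suc; _+_; _*_; _∸_; _⊔_; _≤_; _<_; z≤n; s≤s; z<s; _<ᵇ_; _≤?_; _<?_)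
open import Data.Nat.Properties hiding (_≟_)
open import Algebra.Properties.CommutativeSemigroup +-commutativeSemigroup using (xy∙z≈xz∙y)
open import Algebra.Properties.Semiring.Sum +-*-semiring
  using (sum-syntax; sum-cong-≗; sum-replicate-zero; ∑-distrib-+; ∑-comm; *-distribˡ-sum)
open import Data.Nat.Tactic.RingSolver using (solve-∀)
open import Data.Product using (_×_; _,_; proj₁; proj₂; ∃-syntax)
open import Data.Sum using (_⊎_; inj₁; inj₂; [_,_]′)
open import Function using (_∘_; id)
open import Function.Definitions using (Injective)
open import Level using (0ℓ)
open import Relation.Binary.PropositionalEquality
open import Relation.Nullary using (¬_; Dec; yes; no; does; contradiction)
open import Relation.Nullary.Decidable using (_×-dec_; _⊎-dec_; _→-dec_; ¬?; decidable-stable)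
open import Relation.Unary using (Pred; Decidable; _⊆_)
open import Relation.Unary.Properties using (∅?)

-- Counting over Fin n

-- Both are opaque so that `𝟙 P?` and `count P?` stay rigid under unification (which is what lets
-- the decision procedures be inferred); they are used only through the lemmas below.
opaque
  𝟙 : ∀ {p} {P : Set p} → Dec P → ℕ
  𝟙 P? = if does P? then 1 else 0

module _ {p} {P : Set p} where
  opaque
    unfolding 𝟙

    𝟙-yes : {P? : Dec P} → P → 𝟙 P? ≡ 1
    𝟙-yes {yes _} _ = refl
    𝟙-yes {no ¬p} p = contradiction p ¬p

    𝟙-no : {P? : Dec P} → ¬ P → 𝟙 P? ≡ 0
    𝟙-no {yes p} ¬p = contradiction p ¬p
    𝟙-no {no _} _ = refl

    𝟙-≤ : ∀ {P? : Dec P} {x} → (P → 1 ≤ x) → 𝟙 P? ≤ x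
    𝟙-≤ {yes p} P⇒1≤x = P⇒1≤x p
    𝟙-≤ {no _} _ = z≤n

module _ {p q} {P : Set p} {Q : Set q} where
  opaque
    unfolding 𝟙

    𝟙-mono : {P? : Dec P} {Q? : Dec Q} → (P → Q) → 𝟙 P? ≤ 𝟙 Q?
    𝟙-mono {no _} _ = z≤n
    𝟙-mono {yes _} {yes _} _ = ≤-refl
    𝟙-mono {yes p} {no ¬q} P⇒Q = contradiction (P⇒Q p) ¬q

    𝟙-⊎ : {P? : Dec P} {Q? : Dec Q} → 𝟙 (P? ⊎-dec Q?) ≤ 𝟙 P? + 𝟙 Q?
    𝟙-⊎ {yes _} = s≤s z≤n
    𝟙-⊎ {no _} = ≤-refl

opaque
  count : ∀ {n p} {P : Pred (Fin n) p} → Decidable P → ℕ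
  count {n} P? = ∑[ i < n ] 𝟙 (P? i)

∑-mono-≤ : ∀ {n} {f g : Fin n → ℕ} → (∀ i → f i ≤ g i) → ∑[ i < n ] f i ≤ ∑[ i < n ] g i
∑-mono-≤ {zero} _ = z≤n
∑-mono-≤ {suc n} f≤g = +-mono-≤ (f≤g zero) (∑-mono-≤ (f≤g ∘ suc))

∑-mono-< : ∀ {n} {f g : Fin n → ℕ} (j : Fin n) → (∀ i → f i ≤ g i) → f j < g j →
           ∑[ i < n ] f i < ∑[ i < n ] g i
∑-mono-< zero f≤g fj<gj = +-mono-<-≤ fj<gj (∑-mono-≤ (f≤g ∘ suc))
∑-mono-< (suc j) f≤g fj<gj = +-mono-≤-< (f≤g zero) (∑-mono-< j (f≤g ∘ suc) fj<gj)

≤-∑ : ∀ {n} (f : Fin n → ℕ) (j : Fin n) → f j ≤ ∑[ i < n ] f i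
≤-∑ f zero = m≤m+n _ _
≤-∑ f (suc j) = ≤-trans (≤-∑ (f ∘ suc) j) (m≤n+m _ _)

∑-const : ∀ n c → ∑[ i < n ] c ≡ n * c
∑-const zero c = refl
∑-const (suc n) c = cong (c +_) (∑-const n c)

module _ {n} {P Q : Pred (Fin n) 0ℓ} {P? : Decidable P} {Q? : Decidable Q} where
  opaque
    unfolding count

    count-mono : P ⊆ Q → count P? ≤ count Q?
    count-mono P⊆Q = ∑-mono-≤ {n} {𝟙 ∘ P?} {𝟙 ∘ Q?} (λ _ → 𝟙-mono P⊆Q)

    count-< : ∀ {j} → P ⊆ Q → Q j → ¬ P j → count P? < count Q?
    count-< {j} P⊆Q qj ¬pj = ∑-mono-< {n} {𝟙 ∘ P?} {𝟙 ∘ Q?} j (λ _ → 𝟙-mono P⊆Q)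
      (subst₂ _<_ (sym (𝟙-no {P? = P? j} ¬pj)) (sym (𝟙-yes {P? = Q? j} qj)) z<s)

    count-⊎ : count (λ i → P? i ⊎-dec Q? i) ≤ count P? + count Q?
    count-⊎ = ≤-trans (∑-mono-≤ {n} (λ i → 𝟙-⊎ {P? = P? i} {Q? i}))
                      (≤-reflexive (∑-distrib-+ (𝟙 ∘ P?) (𝟙 ∘ Q?)))

module _ {n} {P : Pred (Fin n) 0ℓ} where
  opaque
    unfolding count

    count≡∑ : (P? : Decidable P) → count P? ≡ ∑[ i < n ] 𝟙 (P? i)
    count≡∑ _ = refl

    count-none : {P? : Decidable P} → (∀ i → ¬ P i) → count P? ≡ 0
    count-none ¬P = trans (sum-cong-≗ (λ i → 𝟙-no (¬P i))) (sum-replicate-zero n)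

    1≤count : {P? : Decidable P} {i : Fin n} → P i → 1 ≤ count P?
    1≤count {P?} {i} pi = subst (_≤ ∑[ j < n ] 𝟙 (P? j)) (𝟙-yes {P? = P? i} pi) (≤-∑ (𝟙 ∘ P?) i)

opaque
  unfolding count

  count≤1 : ∀ {n} {P : Pred (Fin n) 0ℓ} {P? : Decidable P} → (∀ {i j} → P i → P j → i ≡ j) → count P? ≤ 1
  count≤1 {zero} _ = z≤n
  count≤1 {suc n} {P? = P?} unique with P? zero
  ... | yes p₀ = ≤-reflexive (cong₂ _+_ (𝟙-yes {P? = yes p₀} p₀)
                                        (count-none {P? = P? ∘ suc} (λ i pi → Finₚ.0≢1+n (unique p₀ pi))))
  ... | no ¬p₀ = subst (_≤ 1) (cong (_+ count (P? ∘ suc)) (sym (𝟙-no {P? = no ¬p₀} ¬p₀)))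
                   (count≤1 {P? = P? ∘ suc} (λ pi pj → Finₚ.suc-injective (unique pi pj)))

count-≟ : ∀ {n} (x : Fin n) → count (_≟ x) ≤ 1
count-≟ x = count≤1 (λ i≡x j≡x → trans i≡x (sym j≡x))

count-injective : ∀ {m n} {P : Pred (Fin m) 0ℓ} {Q : Pred (Fin n) 0ℓ} {P? : Decidable P} {Q? : Decidable Q}
  {f : Fin m → Fin n} → Injective _≡_ _≡_ f → (∀ {i} → P i → Q (f i)) → count P? ≤ count Q?
count-injective {m} {n} {Q = Q} {P?} {Q?} {f} f-inj P⇒Qf = begin
  count P?                                       ≡⟨ count≡∑ P? ⟩
  ∑[ i < m ] 𝟙 (P? i)                            ≤⟨ ∑-mono-≤ {m} hit ⟩
  ∑[ i < m ] count (λ t → f i ≟ t ×-dec Q? t)    ≡⟨ sum-cong-≗ (λ i → count≡∑ (λ t → f i ≟ t ×-dec Q? t)) ⟩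
  ∑[ i < m ] ∑[ t < n ] 𝟙 (f i ≟ t ×-dec Q? t)   ≡⟨ ∑-comm (λ i t → 𝟙 (f i ≟ t ×-dec Q? t)) ⟩
  ∑[ t < n ] ∑[ i < m ] 𝟙 (f i ≟ t ×-dec Q? t)   ≡⟨ sum-cong-≗ (λ t → count≡∑ (λ i → f i ≟ t ×-dec Q? t)) ⟨
  ∑[ t < n ] count (λ i → f i ≟ t ×-dec Q? t)    ≤⟨ ∑-mono-≤ {n} (λ t → fibre (Q? t)) ⟩
  ∑[ t < n ] 𝟙 (Q? t)                            ≡⟨ count≡∑ Q? ⟨
  count Q?                                       ∎
  where
  open ≤-Reasoning
  hit : ∀ i → 𝟙 (P? i) ≤ count (λ t → f i ≟ t ×-dec Q? t)
  hit i = 𝟙-≤ (λ pi → 1≤count {P? = λ t → f i ≟ t ×-dec Q? t} (refl , P⇒Qf pi))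
  fibre : ∀ {t} (q? : Dec (Q t)) → count (λ i → f i ≟ t ×-dec q?) ≤ 𝟙 q?
  fibre {t} (yes q) = ≤-trans (count≤1 {P? = λ i → f i ≟ t ×-dec yes q}
                                       (λ (fi≡t , _) (fj≡t , _) → f-inj (trans fi≡t (sym fj≡t))))
                              (≤-reflexive (sym (𝟙-yes {P? = yes q} q)))
  fibre {t} (no ¬q) = ≤-trans (≤-reflexive (count-none {P? = λ i → f i ≟ t ×-dec no ¬q} (λ _ → ¬q ∘ proj₂))) z≤n

opaque
  unfolding 𝟙 count

  countL-tabulate : ∀ {A : Set} (p : A → Bool) {n} (g : Fin n → A) →
                    countL p (tabulate g) ≡ count (λ i → p (g i) Bool.≟ true)
  countL-tabulate p {zero} g = refl
  countL-tabulate p {suc n} g with does (p (g zero) Bool.≟ true)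
  ... | true = cong suc (countL-tabulate p (g ∘ suc))
  ... | false = countL-tabulate p (g ∘ suc)

countL-++ : ∀ {A : Set} (p : A → Bool) xs ys → countL p (xs ++ ys) ≡ countL p xs + countL p ys
countL-++ p xs ys =
  trans (cong length (filter-++ (λ x → p x Bool.≟ true) xs ys)) (length-++ (filter (λ x → p x Bool.≟ true) xs))

countL-pairs : ∀ {n} (p : Fin n × Fin n → Bool) →
               countL p (pairs n) ≡ ∑[ i < n ] count (λ j → p (i , j) Bool.≟ true)
countL-pairs {n} p = rows id
  where
  row : Fin n → List (Fin n × Fin n)
  row i = map (i ,_) (allFin n)
  rows : ∀ {k} (g : Fin k → Fin n) →
         countL p (concatMap row (tabulate g)) ≡ ∑[ i < k ] count (λ j → p (g i , j) Bool.≟ true)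
  rows {zero} g = refl
  rows {suc k} g = begin
    countL p (row (g zero) ++ concatMap row (tabulate (g ∘ suc)))            ≡⟨ countL-++ p (row (g zero)) _ ⟩
    countL p (row (g zero)) + countL p (concatMap row (tabulate (g ∘ suc)))  ≡⟨ cong₂ _+_ first (rows (g ∘ suc)) ⟩
    count (λ j → p (g zero , j) Bool.≟ true) + _                              ∎
    where
    open ≡-Reasoning
    first : countL p (row (g zero)) ≡ count (λ j → p (g zero , j) Bool.≟ true)
    first = trans (cong (countL p) (map-tabulate id (g zero ,_))) (countL-tabulate p (g zero ,_))

-- Degrees and cliques

IsEdge? : ∀ {n} (G : Graph n) x y → Dec (IsEdge G x y)
IsEdge? G x y = adj G x y Bool.≟ true

module _ {n} (G : Graph n) where

  IsEdge-sym : ∀ {x y} → IsEdge G x y → IsEdge G y x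
  IsEdge-sym {x} {y} e = trans (adj-sym G y x) e

  IsEdge⇒≢ : ∀ {x y} → IsEdge G x y → x ≢ y
  IsEdge⇒≢ {x} e refl = contradiction (trans (sym e) (adj-irrefl G x)) λ ()

  deg≡count : ∀ v → deg G v ≡ count (IsEdge? G v)
  deg≡count v = countL-tabulate (adj G v) id

  edge↑ : Fin n → Fin n → ℕ
  edge↑ i j = 𝟙 (((toℕ i <ᵇ toℕ j) ∧ adj G i j) Bool.≟ true)

  opaque
    unfolding 𝟙

    𝟙-edge : ∀ i j → 𝟙 (IsEdge? G i j) ≡ edge↑ i j + edge↑ j i
    𝟙-edge i j with toℕ i <ᵇ toℕ j in i<ᵇj | toℕ j <ᵇ toℕ i in j<ᵇi
    ... | true  | true  = contradiction (<ᵇ⇒< (toℕ j) (toℕ i) (subst T (sym j<ᵇi) _))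
                                        (<⇒≯ (<ᵇ⇒< (toℕ i) (toℕ j) (subst T (sym i<ᵇj) _)))
    ... | true  | false = sym (+-identityʳ _)
    ... | false | true  = cong (λ b → 𝟙 (b Bool.≟ true)) (adj-sym G i j)
    ... | false | false = cong (λ b → 𝟙 (b Bool.≟ true)) (subst (λ z → adj G i z ≡ false) i≡j (adj-irrefl G i))
      where
      i≡j : i ≡ j
      i≡j = toℕ-injective (≤-antisym (≮⇒≥ (λ j<i → subst T j<ᵇi (<⇒<ᵇ j<i)))
                                     (≮⇒≥ (λ i<j → subst T i<ᵇj (<⇒<ᵇ i<j))))

  handshake : ∑[ v < n ] deg G v ≡ 2 * edgeCount G
  handshake = begin
    ∑[ i < n ] deg G i                                        ≡⟨ sum-cong-≗ (λ i → deg≡count i) ⟩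
    ∑[ i < n ] count (IsEdge? G i)                            ≡⟨ sum-cong-≗ (λ i → count≡∑ (IsEdge? G i)) ⟩
    ∑[ i < n ] ∑[ j < n ] 𝟙 (IsEdge? G i j)                   ≡⟨ sum-cong-≗ split ⟩
    ∑[ i < n ] (∑[ j < n ] edge↑ i j + ∑[ j < n ] edge↑ j i)  ≡⟨ ∑-distrib-+ (λ i → ∑[ j < n ] edge↑ i j) _ ⟩
    E + ∑[ i < n ] ∑[ j < n ] edge↑ j i                       ≡⟨ cong (E +_) (∑-comm (λ i j → edge↑ j i)) ⟩
    E + E                                                     ≡⟨ cong (E +_) (+-identityʳ E) ⟨
    2 * E                                                     ≡⟨ cong (2 *_) edgeCount≡E ⟨
    2 * edgeCount G                                           ∎
    where
    open ≡-Reasoning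
    E : ℕ
    E = ∑[ i < n ] ∑[ j < n ] edge↑ i j
    split : ∀ i → ∑[ j < n ] 𝟙 (IsEdge? G i j) ≡ ∑[ j < n ] edge↑ i j + ∑[ j < n ] edge↑ j i
    split i = trans (sum-cong-≗ (𝟙-edge i)) (∑-distrib-+ (edge↑ i) (λ j → edge↑ j i))
    edgeCount≡E : edgeCount G ≡ E
    edgeCount≡E = trans (countL-pairs (λ (i , j) → (toℕ i <ᵇ toℕ j) ∧ adj G i j))
                        (sum-cong-≗ (λ i → count≡∑ (λ j → ((toℕ i <ᵇ toℕ j) ∧ adj G i j) Bool.≟ true)))

  ∑-degree : ∀ D → ∑[ v < n ] (D * deg G v) ≡ D * (2 * edgeCount G)
  ∑-degree D = trans (sym (*-distribˡ-sum D (deg G))) (cong (D *_) handshake)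

IsClique : ∀ {n} → Graph n → Pred (Fin n) 0ℓ → Set
IsClique G S = ∀ {x y} → S x → S y → x ≢ y → IsEdge G x y

IsIndependent : ∀ {n} → Graph n → Pred (Fin n) 0ℓ → Set
IsIndependent G S = ∀ {x y} → S x → S y → ¬ IsEdge G x y

module _ {n} {G : Graph n} {S : Pred (Fin n) 0ℓ} {S? : Decidable S} where

  clique-count : IsClique G S → ∀ {B} → (∀ {x} → S x → deg G x ≤ B) → count S? ≤ suc B
  clique-count clique {B} deg≤B with any? S?
  ... | no ∄S = ≤-trans (≤-reflexive (count-none (λ x sx → ∄S (x , sx)))) z≤n
  ... | yes (x₀ , s₀) = begin
    count S?                                      ≤⟨ count-mono (λ {x} → star x) ⟩
    count (λ x → (x ≟ x₀) ⊎-dec IsEdge? G x₀ x)   ≤⟨ count-⊎ ⟩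
    count (_≟ x₀) + count (IsEdge? G x₀)          ≡⟨ cong (count (_≟ x₀) +_) (deg≡count G x₀) ⟨
    count (_≟ x₀) + deg G x₀                      ≤⟨ +-mono-≤ (count-≟ x₀) (deg≤B s₀) ⟩
    suc B                                         ∎
    where
    open ≤-Reasoning
    star : ∀ x → S x → x ≡ x₀ ⊎ IsEdge G x₀ x
    star x sx with x ≟ x₀
    ... | yes x≡x₀ = inj₁ x≡x₀
    ... | no x≢x₀ = inj₂ (clique s₀ sx (x≢x₀ ∘ sym))

  clique-independent-count : IsClique G S → IsIndependent G S → count S? ≤ 1
  clique-independent-count clique indep = count≤1 λ {x} {y} sx sy →
    decidable-stable (x ≟ y) (λ x≢y → indep sx sy (clique sx sy x≢y))

HasNbrOfDeg≥ : ∀ {n} → Graph n → ℕ → Pred (Fin n) 0ℓ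
HasNbrOfDeg≥ G B v = ∃[ t ] (IsEdge G v t × B ≤ deg G t)

HasNbrOfDeg≥? : ∀ {n} (G : Graph n) B → Decidable (HasNbrOfDeg≥ G B)
HasNbrOfDeg≥? G B v = any? (λ t → IsEdge? G v t ×-dec (B ≤? deg G t))

HasNbrOfDeg≥-mono : ∀ {n} {G : Graph n} {A B v} → A ≤ B → HasNbrOfDeg≥ G B v → HasNbrOfDeg≥ G A v
HasNbrOfDeg≥-mono A≤B (t , vt , B≤dt) = t , vt , ≤-trans A≤B B≤dt

¬HasNbrOfDeg≥⇒deg≤ : ∀ {n} {G : Graph n} {B v t} → ¬ HasNbrOfDeg≥ G (suc B) v → IsEdge G v t → deg G t ≤ B
¬HasNbrOfDeg≥⇒deg≤ ¬heavy vt = ≮⇒≥ (λ B<dt → ¬heavy (_ , vt , B<dt))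

-- The parameters of H

minL-≤ : ∀ {x} xs → x ∈ xs → minL xs ≤ x
minL-≤ (x ∷ []) (here refl) = ≤-refl
minL-≤ (x ∷ y ∷ ys) (here refl) = m⊓n≤m x _
minL-≤ (x ∷ y ∷ ys) (there z∈) = ≤-trans (m⊓n≤n x _) (minL-≤ (y ∷ ys) z∈)

minL-∈ : ∀ {x} xs → x ∈ xs → minL xs ∈ xs
minL-∈ (x ∷ xs) _ = minL-∈-∷ x xs
  where
  minL-∈-∷ : ∀ x xs → minL (x ∷ xs) ∈ x ∷ xs
  minL-∈-∷ x [] = here refl
  minL-∈-∷ x (y ∷ ys) = [ here , (λ eq → there (subst (_∈ y ∷ ys) (sym eq) (minL-∈-∷ y ys))) ]′
                          (⊓-sel x (minL (y ∷ ys)))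

maxL-≤ : ∀ {B xs} → All (_≤ B) xs → maxL xs ≤ B
maxL-≤ [] = z≤n
maxL-≤ (x≤B ∷ xs≤B) = ⊔-lub x≤B (maxL-≤ xs≤B)

maxL-witness : ∀ {B} xs → 0 < B → B ≤ maxL xs → Any (B ≤_) xs
maxL-witness [] 0<B B≤0 = contradiction B≤0 (<⇒≱ 0<B)
maxL-witness (x ∷ xs) 0<B B≤max with ⊔-sel x (maxL xs)
... | inj₁ eq = here (subst (_ ≤_) eq B≤max)
... | inj₂ eq = there (maxL-witness xs 0<B (subst (_ ≤_) eq B≤max))

module _ {m} (H : Graph m) where

  edge∈edgesL : ∀ {u v} → IsEdge H u v → (u , v) ∈ edgesL H
  edge∈edgesL {u} {v} e = ∈-filter⁺ (λ p → adj H (proj₁ p) (proj₂ p) Bool.≟ true) pair∈ e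
    where
    pair∈ : (u , v) ∈ pairs m
    pair∈ = ∈-concat⁺′ (∈-map⁺ (u ,_) (∈-allFin v)) (∈-map⁺ (λ i → map (i ,_) (allFin m)) (∈-allFin u))

  k0≤wt0 : ∀ {u v} → IsEdge H u v → k0 H ≤ wt0 H (u , v)
  k0≤wt0 e = minL-≤ _ (∈-map⁺ (wt0 H) (edge∈edgesL e))

  k1≤wt1 : ∀ {u v} → IsEdge H u v → k1 H ≤ wt1 H (u , v)
  k1≤wt1 e = minL-≤ _ (∈-map⁺ (wt1 H) (edge∈edgesL e))

  k1′≤wt1 : ∀ {u v} → IsEdge H u v → wt0 H (u , v) ≡ k0 H → k1′ H ≤ wt1 H (u , v)
  k1′≤wt1 e wt0≡k0 =
    minL-≤ _ (∈-map⁺ (wt1 H) (∈-filter⁺ (λ e → wt0 H e Data.Nat.≟ k0 H) (edge∈edgesL e) wt0≡k0))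

  k0′≤wt0 : ∀ {u v} → IsEdge H u v → wt1 H (u , v) ≡ k1 H → k0′ H ≤ wt0 H (u , v)
  k0′≤wt0 e wt1≡k1 =
    minL-≤ _ (∈-map⁺ (wt0 H) (∈-filter⁺ (λ e → wt1 H e Data.Nat.≟ k1 H) (edge∈edgesL e) wt1≡k1))

  k1≤k1′ : HasEdge H → k1 H ≤ k1′ H
  k1≤k1′ (u , v , e) =
    let e₀ , e₀∈ , k0≡wt0 = ∈-map⁻ (wt0 H) (minL-∈ _ (∈-map⁺ (wt0 H) (edge∈edgesL e)))
        e₁ , e₁∈ , k1′≡wt1 = ∈-map⁻ (wt1 H) (minL-∈ _ (∈-map⁺ (wt1 H) (∈-filter⁺ wt0≟k0 e₀∈ (sym k0≡wt0))))
    in subst (k1 H ≤_) (sym k1′≡wt1) (minL-≤ _ (∈-map⁺ (wt1 H) (proj₁ (∈-filter⁻ wt0≟k0 {xs = edgesL H} e₁∈))))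
    where
    wt0≟k0 : ∀ e → Dec (wt0 H e ≡ k0 H)
    wt0≟k0 e = wt0 H e Data.Nat.≟ k0 H

  wt1-≤ : ∀ {u v B} → (∀ {w} → inNbhd H u v w ≡ true → deg H w ≤ B) → wt1 H (u , v) ≤ B
  wt1-≤ {u} {v} bound =
    maxL-≤ (Allₚ.map⁺ (All.map bound (all-filter (λ w → inNbhd H u v w Bool.≟ true) (allFin m))))

  wt1-witness : ∀ {u v B} → 0 < B → B ≤ wt1 H (u , v) → ∃[ w ] (inNbhd H u v w ≡ true × B ≤ deg H w)
  wt1-witness {u} {v} {B} 0<B B≤wt1 =
    Any.lookup heavy , lookupAny (all-filter (λ w → inNbhd H u v w Bool.≟ true) (allFin m)) heavy
    where
    heavy : Any (λ w → B ≤ deg H w) (filter (λ w → inNbhd H u v w Bool.≟ true) (allFin m))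
    heavy = Anyₚ.map⁻ (maxL-witness _ 0<B B≤wt1)

-- Adding a non-edge to a saturated graph

addEdge-cases : ∀ {n} (G : Graph n) {x y a b} → addEdge G x y a b ≡ true →
                IsEdge G a b ⊎ (a ≡ x × b ≡ y) ⊎ (a ≡ y × b ≡ x)
addEdge-cases G {x} {y} {a} {b} e with adj G a b | a ≟ x | b ≟ y | a ≟ y | b ≟ x
... | true  | _      | _      | _      | _      = inj₁ refl
... | false | yes ax | yes by | _      | _      = inj₂ (inj₁ (ax , by))
... | false | _      | _      | yes ay | yes bx = inj₂ (inj₂ (ay , bx))
addEdge-cases G () | false | no _  | _    | no _  | _
addEdge-cases G () | false | no _  | _    | yes _ | no _
addEdge-cases G () | false | yes _ | no _ | no _  | _
addEdge-cases G () | false | yes _ | no _ | yes _ | no _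

inNbhd-cases : ∀ {m} (H : Graph m) {u v w} → inNbhd H u v w ≡ true →
               (IsEdge H u w × w ≢ v) ⊎ (IsEdge H v w × w ≢ u)
inNbhd-cases H {u} {v} {w} e with adj H u w | w ≟ v | adj H v w | w ≟ u
... | true | no w≢v | _    | _      = inj₁ (refl , w≢v)
... | _    | _      | true | no w≢u = inj₂ (refl , w≢u)
inNbhd-cases H () | true  | yes _ | false | _
inNbhd-cases H () | true  | yes _ | true  | yes _
inNbhd-cases H () | false | _     | false | _
inNbhd-cases H () | false | _     | true  | yes _

-- A copy of H in G + xy that is not a copy in G uses xy, as the image of an edge uv of H.
record CopyThrough {m n} (H : Graph m) (G : Graph n) (x y : Fin n) : Set where
  field
    u v  : Fin m
    edge : IsEdge H u v
    wt0≤ : wt0 H (u , v) ≤ deg G x ⊔ deg G y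
    nbhd : ∀ {w} → inNbhd H u v w ≡ true → ∃[ t ] ((IsEdge G x t ⊎ IsEdge G y t) × deg H w ≤ deg G t)

module _ {m n} {H : Graph m} {G : Graph n} {x y : Fin n} (x≢y : x ≢ y)
         {f : Fin m → Fin n} (f-inj : Injective _≡_ _≡_ f)
         (hom : ∀ i j → IsEdge H i j → addEdge G x y (f i) (f j) ≡ true) where

  private
    new-nbr-x : ∀ {t} → addEdge G x y x t ≡ true → IsEdge G x t ⊎ t ≡ y
    new-nbr-x e with addEdge-cases G e
    ... | inj₁ xt = inj₁ xt
    ... | inj₂ (inj₁ (_ , t≡y)) = inj₂ t≡y
    ... | inj₂ (inj₂ (x≡y , _)) = contradiction x≡y x≢y

    new-nbr-y : ∀ {t} → addEdge G x y y t ≡ true → IsEdge G y t ⊎ t ≡ x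
    new-nbr-y e with addEdge-cases G e
    ... | inj₁ yt = inj₁ yt
    ... | inj₂ (inj₁ (y≡x , _)) = contradiction (sym y≡x) x≢y
    ... | inj₂ (inj₂ (_ , t≡x)) = inj₂ t≡x

    old-edge : ∀ {a b} → a ≢ x → a ≢ y → addEdge G x y a b ≡ true → IsEdge G a b
    old-edge a≢x a≢y e with addEdge-cases G e
    ... | inj₁ ab = ab
    ... | inj₂ (inj₁ (a≡x , _)) = contradiction a≡x a≢x
    ... | inj₂ (inj₂ (a≡y , _)) = contradiction a≡y a≢y

    hom-at : ∀ {a a′ w} → f a ≡ a′ → IsEdge H a w → addEdge G x y a′ (f w) ≡ true
    hom-at refl e = hom _ _ e

    deg-endpoint : ∀ {a a′ b′} → f a ≡ a′ → (∀ {t} → addEdge G x y a′ t ≡ true → IsEdge G a′ t ⊎ t ≡ b′) →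
                   deg H a ≤ suc (deg G a′)
    deg-endpoint {a} {a′} {b′} fa≡a′ new-nbr = begin
      deg H a                                       ≡⟨ deg≡count H a ⟩
      count (IsEdge? H a)                           ≤⟨ count-injective f-inj (new-nbr ∘ hom-at fa≡a′) ⟩
      count (λ t → IsEdge? G a′ t ⊎-dec (t ≟ b′))   ≤⟨ count-⊎ ⟩
      count (IsEdge? G a′) + count (_≟ b′)          ≤⟨ +-mono-≤ (≤-reflexive (sym (deg≡count G a′))) (count-≟ b′) ⟩
      deg G a′ + 1                                  ≡⟨ +-comm (deg G a′) 1 ⟩
      suc (deg G a′)                                ∎
      where open ≤-Reasoning

    deg-inner : ∀ {w} → f w ≢ x → f w ≢ y → deg H w ≤ deg G (f w)
    deg-inner {w} fw≢x fw≢y = begin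
      deg H w                    ≡⟨ deg≡count H w ⟩
      count (IsEdge? H w)        ≤⟨ count-injective f-inj (old-edge fw≢x fw≢y ∘ hom _ _) ⟩
      count (IsEdge? G (f w))    ≡⟨ deg≡count G (f w) ⟨
      deg G (f w)                ∎
      where open ≤-Reasoning

  copy-through-edge : ∀ {u v} → IsEdge H u v → f u ≡ x → f v ≡ y → CopyThrough H G x y
  copy-through-edge {u} {v} uv fu≡x fv≡y = record
    { u = u ; v = v ; edge = uv
    ; wt0≤ = ∸-monoˡ-≤ 1 (⊔-mono-≤ (deg-endpoint fu≡x new-nbr-x) (deg-endpoint fv≡y new-nbr-y))
    ; nbhd = nbhd
    }
    where
    avoids : ∀ {w} → w ≢ u → w ≢ v → f w ≢ x × f w ≢ y
    avoids w≢u w≢v = (λ fw≡x → w≢u (f-inj (trans fw≡x (sym fu≡x))))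
                   , (λ fw≡y → w≢v (f-inj (trans fw≡y (sym fv≡y))))
    nbhd : ∀ {w} → inNbhd H u v w ≡ true → ∃[ t ] ((IsEdge G x t ⊎ IsEdge G y t) × deg H w ≤ deg G t)
    nbhd {w} w∈N with inNbhd-cases H w∈N
    ... | inj₁ (uw , w≢v) = let fw≢x , fw≢y = avoids (IsEdge⇒≢ H uw ∘ sym) w≢v in
      f w , [ inj₁ , (λ fw≡y → contradiction fw≡y fw≢y) ]′ (new-nbr-x (hom-at fu≡x uw)) , deg-inner fw≢x fw≢y
    ... | inj₂ (vw , w≢u) = let fw≢x , fw≢y = avoids w≢u (IsEdge⇒≢ H vw ∘ sym) in
      f w , [ inj₂ , (λ fw≡x → contradiction fw≡x fw≢x) ]′ (new-nbr-y (hom-at fv≡y vw)) , deg-inner fw≢x fw≢y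

¬∀edge⟶∃edge¬ : ∀ {m} (H : Graph m) {R : Fin m → Fin m → Set} → (∀ i j → Dec (R i j)) →
                ¬ (∀ i j → IsEdge H i j → R i j) → ∃[ i ] ∃[ j ] (IsEdge H i j × ¬ R i j)
¬∀edge⟶∃edge¬ {m} H R? ¬all
  with ¬∀⟶∃¬ m _ (λ i → all? (λ j → IsEdge? H i j →-dec R? i j)) ¬all
... | i , ¬all-i with ¬∀⟶∃¬ m _ (λ j → IsEdge? H i j →-dec R? i j) ¬all-i
... | j , ¬imp = i , j , decidable-stable (IsEdge? H i j) (λ ¬ij → ¬imp (λ ij → contradiction ij ¬ij))
                     , (λ r → ¬imp (λ _ → r))

copyThrough : ∀ {m n} {H : Graph m} {G : Graph n} → Saturated H G →
              ∀ {x y} → x ≢ y → ¬ IsEdge G x y → CopyThrough H G x y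
copyThrough {H = H} {G} (no-copy , saturating) {x} {y} x≢y ¬xy
  with saturating x y x≢y (¬-not ¬xy)
... | f , f-inj , hom
  with ¬∀edge⟶∃edge¬ H (λ i j → IsEdge? G (f i) (f j)) (λ hom′ → no-copy (f , f-inj , hom′))
... | i , j , ij , ¬fij
  with addEdge-cases G (hom i j ij)
... | inj₁ fij = contradiction fij ¬fij
... | inj₂ (inj₁ (fi≡x , fj≡y)) = copy-through-edge x≢y f-inj hom ij fi≡x fj≡y
... | inj₂ (inj₂ (fi≡y , fj≡x)) = copy-through-edge x≢y f-inj hom (IsEdge-sym H ij) fj≡x fi≡y

module _ {m n} {H : Graph m} {G : Graph n} {x y} (c : CopyThrough H G x y) where
  open CopyThrough c

  copy-k0≤ : k0 H ≤ deg G x ⊔ deg G y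
  copy-k0≤ = ≤-trans (k0≤wt0 H edge) wt0≤

  copy-heavyNbr : ∀ {B} → 0 < B → B ≤ wt1 H (u , v) → HasNbrOfDeg≥ G B x ⊎ HasNbrOfDeg≥ G B y
  copy-heavyNbr 0<B B≤wt1 with wt1-witness H 0<B B≤wt1
  ... | w , w∈N , B≤dw with nbhd w∈N
  ...   | t , inj₁ xt , dw≤dt = inj₁ (t , xt , ≤-trans B≤dw dw≤dt)
  ...   | t , inj₂ yt , dw≤dt = inj₂ (t , yt , ≤-trans B≤dw dw≤dt)

  copy-wt1≤ : ∀ {B} → (∀ {t} → IsEdge G x t ⊎ IsEdge G y t → deg G t ≤ B) → wt1 H (u , v) ≤ B
  copy-wt1≤ bound = wt1-≤ H (λ w∈N → let _ , xy-t , dw≤dt = nbhd w∈N in ≤-trans dw≤dt (bound xy-t))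

-- Discharging

discharging : ∀ {n} (c : Fin n → ℕ) (τ : Fin n → Fin n → ℕ) (T : ℕ) {X : Pred (Fin n) 0ℓ} (X? : Decidable X) →
              (∀ v → ∑[ t < n ] τ v t ≤ c v) →
              (∀ v → ¬ X v → T + ∑[ t < n ] τ v t ≤ c v + ∑[ t < n ] τ t v) →
              n * T ≤ ∑[ v < n ] c v + T * count X?
discharging {n} c τ T {X} X? out≤c balanced = +-cancelʳ-≤ Out (n * T) _ (begin
  n * T + Out                                           ≡⟨ cong (_+ Out) (∑-const n T) ⟨
  ∑[ v < n ] T + Out                                    ≡⟨ ∑-distrib-+ (λ _ → T) out ⟨
  ∑[ v < n ] (T + out v)                                ≤⟨ ∑-mono-≤ (λ v → charge v (X? v)) ⟩
  ∑[ v < n ] (c v + in′ v + T * 𝟙 (X? v))                ≡⟨ ∑-distrib-+ (λ v → c v + in′ v) _ ⟩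
  ∑[ v < n ] (c v + in′ v) + ∑[ v < n ] (T * 𝟙 (X? v))  ≡⟨ cong₂ _+_ (∑-distrib-+ c in′)
                                                                     (sym (*-distribˡ-sum T (𝟙 ∘ X?))) ⟩
  C + In + T * ∑[ v < n ] 𝟙 (X? v)                      ≡⟨ cong₂ (λ a b → C + a + T * b) (∑-comm τ) (count≡∑ X?) ⟨
  C + Out + T * count X?                                ≡⟨ xy∙z≈xz∙y C Out (T * count X?) ⟩
  C + T * count X? + Out                                ∎)
  where
  open ≤-Reasoning
  out in′ : Fin n → ℕ
  out v = ∑[ t < n ] τ v t
  in′ v = ∑[ t < n ] τ t v
  C Out In : ℕ
  C = ∑[ v < n ] c v
  Out = ∑[ v < n ] out v
  In = ∑[ v < n ] in′ v
  charge : ∀ v (x? : Dec (X v)) → T + out v ≤ c v + in′ v + T * 𝟙 x?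
  charge v (yes x) = begin
    T + out v                   ≤⟨ +-monoʳ-≤ T (≤-trans (out≤c v) (m≤m+n (c v) (in′ v))) ⟩
    T + (c v + in′ v)           ≡⟨ +-comm T _ ⟩
    c v + in′ v + T             ≡⟨ cong (c v + in′ v +_) (*-identityʳ T) ⟨
    c v + in′ v + T * 1         ≡⟨ cong (λ i → c v + in′ v + T * i) (𝟙-yes {P? = yes x} x) ⟨
    c v + in′ v + T * 𝟙 (yes x) ∎
  charge v (no ¬x) = begin
    T + out v                   ≤⟨ balanced v ¬x ⟩
    c v + in′ v                 ≡⟨ +-identityʳ _ ⟨
    c v + in′ v + 0             ≡⟨ cong (c v + in′ v +_) (*-zeroʳ T) ⟨
    c v + in′ v + T * 0         ≡⟨ cong (λ i → c v + in′ v + T * i) (𝟙-no {P? = no ¬x} ¬x) ⟨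
    c v + in′ v + T * 𝟙 (no ¬x) ∎

lowNbrs : ∀ {n} → Graph n → ℕ → Fin n → ℕ
lowNbrs G k v = count (λ t → IsEdge? G v t ×-dec (deg G t ≤? k))

module _ {n} (G : Graph n) {k : ℕ} where

  lowNbrs≤deg : ∀ v → lowNbrs G k v ≤ deg G v
  lowNbrs≤deg v = ≤-trans (count-mono proj₁) (≤-reflexive (sym (deg≡count G v)))

  lowNbrs<deg : ∀ {v} → HasNbrOfDeg≥ G (suc k) v → lowNbrs G k v < deg G v
  lowNbrs<deg {v} (t , vt , k<dt) =
    ≤-trans (count-< {j = t} proj₁ vt (λ (_ , dt≤k) → <⇒≱ k<dt dt≤k)) (≤-reflexive (sym (deg≡count G v)))

-- After sending b to each of its neighbours of degree ≤ k, v still has charge ≥ k·D + b.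
Affords : ∀ {n} → Graph n → (k D b : ℕ) → Fin n → Set
Affords G k D b v = k * D + b * suc (lowNbrs G k v) ≤ D * deg G v

Small : ∀ {n} → Graph n → ℕ → Pred (Fin n) 0ℓ
Small G k v = deg G v < k

Small? : ∀ {n} (G : Graph n) k → Decidable (Small G k)
Small? G k v = deg G v <? k

Starved : ∀ {n} → Graph n → ℕ → ℕ → Pred (Fin n) 0ℓ
Starved G k K v = deg G v ≤ k × ¬ HasNbrOfDeg≥ G K v

Starved? : ∀ {n} (G : Graph n) k K → Decidable (Starved G k K)
Starved? G k K v = (deg G v ≤? k) ×-dec ¬? (HasNbrOfDeg≥? G K v)

StarCentre : ∀ {n} → Graph n → ℕ → ℕ → Pred (Fin n) 0ℓ
StarCentre G k K v = K ≤ deg G v × ¬ HasNbrOfDeg≥ G (suc k) v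

StarCentre? : ∀ {n} (G : Graph n) k K → Decidable (StarCentre G k K)
StarCentre? G k K v = (K ≤? deg G v) ×-dec ¬? (HasNbrOfDeg≥? G (suc k) v)

starCentre-independent : ∀ {n} {G : Graph n} {k K} → k < K → IsIndependent G (StarCentre G k K)
starCentre-independent k<K (_ , ¬heavy-x) (K≤dy , _) xy = ¬heavy-x (_ , xy , ≤-trans k<K K≤dy)

module Transfer {n} (G : Graph n) (k K b : ℕ) where

  Sends : Fin n → Fin n → Set
  Sends v t = K ≤ deg G v × IsEdge G v t × deg G t ≤ k

  Sends? : ∀ v t → Dec (Sends v t)
  Sends? v t = (K ≤? deg G v) ×-dec (IsEdge? G v t ×-dec (deg G t ≤? k))

  send : Fin n → Fin n → ℕ
  send v t = b * 𝟙 (Sends? v t)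

  sent≤ : ∀ v → ∑[ t < n ] send v t ≤ b * lowNbrs G k v
  sent≤ v = begin
    ∑[ t < n ] send v t             ≡⟨ *-distribˡ-sum b (𝟙 ∘ Sends? v) ⟨
    b * ∑[ t < n ] 𝟙 (Sends? v t)   ≡⟨ cong (b *_) (count≡∑ (Sends? v)) ⟨
    b * count (Sends? v)            ≤⟨ *-monoʳ-≤ b (count-mono proj₂) ⟩
    b * lowNbrs G k v               ∎
    where open ≤-Reasoning

  sent-light : ∀ {v} → deg G v < K → ∑[ t < n ] send v t ≡ 0
  sent-light {v} dv<K = trans (sum-cong-≗ nothing) (sum-replicate-zero n)
    where
    nothing : ∀ t → send v t ≡ 0
    nothing t = trans (cong (b *_) (𝟙-no {P? = Sends? v t} (λ (K≤dv , _) → <⇒≱ dv<K K≤dv))) (*-zeroʳ b)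

  received≥ : ∀ {v} → deg G v ≤ k → HasNbrOfDeg≥ G K v → b ≤ ∑[ t < n ] send t v
  received≥ {v} dv≤k (t , vt , K≤dt) = begin
    b                     ≡⟨ *-identityʳ b ⟨
    b * 1                 ≡⟨ cong (b *_) (𝟙-yes (K≤dt , IsEdge-sym G vt , dv≤k)) ⟨
    send t v              ≤⟨ ≤-∑ (λ t → send t v) t ⟩
    ∑[ t < n ] send t v   ∎
    where open ≤-Reasoning

-- n·(k + b/D) ≤ 2e + O(1) with the denominator cleared; suc k + (suc k + 1) bounds the number of
-- vertices that may end below the target charge k·D + b.
ChargeBound : (n e k D b : ℕ) → Set
ChargeBound n e k D b = n * (k * D + b) ≤ D * (2 * e) + (k * D + b) * (suc k + (suc k + 1))

k*D+b≤D*[1+k] : ∀ k {D b} → b ≤ D → k * D + b ≤ D * suc k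
k*D+b≤D*[1+k] k {D} {b} b≤D = begin
  k * D + b    ≤⟨ +-mono-≤ (≤-reflexive (*-comm k D)) b≤D ⟩
  D * k + D    ≡⟨ +-comm (D * k) D ⟩
  D + D * k    ≡⟨ *-suc D k ⟨
  D * suc k    ∎
  where open ≤-Reasoning

chargeBound-small : ∀ {n} (G : Graph n) {k} D → IsClique G (Small G k) → ChargeBound n (edgeCount G) k D 0
chargeBound-small {n} G {k} D small = begin
  n * target                                              ≤⟨ discharging (λ v → D * deg G v) (λ _ _ → 0) target
                                                                         (Small? G k) no-out balanced ⟩
  ∑[ v < n ] (D * deg G v) + target * count (Small? G k)  ≤⟨ +-mono-≤ (≤-reflexive (∑-degree G D))
                                                                      (*-monoʳ-≤ target small≤) ⟩
  D * (2 * edgeCount G) + target * (suc k + (suc k + 1))  ∎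
  where
  open ≤-Reasoning
  target : ℕ
  target = k * D + 0
  no-out : ∀ v → ∑[ t < n ] 0 ≤ D * deg G v
  no-out _ = ≤-trans (≤-reflexive (sum-replicate-zero n)) z≤n
  balanced : ∀ v → ¬ Small G k v → target + ∑[ t < n ] 0 ≤ D * deg G v + ∑[ t < n ] 0
  balanced v ¬small =
    +-monoˡ-≤ _ (≤-trans (≤-reflexive (trans (+-identityʳ _) (*-comm k D))) (*-monoʳ-≤ D (≮⇒≥ ¬small)))
  small≤ : count (Small? G k) ≤ suc k + (suc k + 1)
  small≤ = ≤-trans (clique-count {G = G} {S? = Small? G k} small <⇒≤) (m≤m+n _ _)

module _ {n} (G : Graph n) {k K : ℕ} (k<K : k < K) {D b : ℕ} (b≤D : b ≤ D)
         {X : Pred (Fin n) 0ℓ} (X? : Decidable X) (affords : ∀ v → K ≤ deg G v → ¬ X v → Affords G k D b v) where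

  open Transfer G k K b
  open ≤-Reasoning

  private
    target : ℕ
    target = k * D + b

    Exceptional : Pred (Fin n) 0ℓ
    Exceptional v = Small G k v ⊎ Starved G k K v ⊎ X v

    Exceptional? : Decidable Exceptional
    Exceptional? v = Small? G k v ⊎-dec (Starved? G k K v ⊎-dec X? v)

    Balanced : Fin n → Set
    Balanced v = target + ∑[ t < n ] send v t ≤ D * deg G v + ∑[ t < n ] send t v

    balanced-low : ∀ {v} → deg G v ≤ k → k ≤ deg G v → HasNbrOfDeg≥ G K v → Balanced v
    balanced-low {v} dv≤k k≤dv heavy = begin
      target + ∑[ t < n ] send v t       ≡⟨ cong (target +_) (sent-light (≤-<-trans dv≤k k<K)) ⟩
      target + 0                         ≡⟨ +-identityʳ target ⟩
      k * D + b                          ≤⟨ +-mono-≤ (≤-trans (≤-reflexive (*-comm k D)) (*-monoʳ-≤ D k≤dv))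
                                                     (received≥ dv≤k heavy) ⟩
      D * deg G v + ∑[ t < n ] send t v  ∎

    balanced-mid : ∀ {v} → k < deg G v → deg G v < K → Balanced v
    balanced-mid {v} k<dv dv<K = begin
      target + ∑[ t < n ] send v t       ≡⟨ cong (target +_) (sent-light dv<K) ⟩
      target + 0                         ≡⟨ +-identityʳ target ⟩
      k * D + b                          ≤⟨ k*D+b≤D*[1+k] k b≤D ⟩
      D * suc k                          ≤⟨ *-monoʳ-≤ D k<dv ⟩
      D * deg G v                        ≤⟨ m≤m+n _ _ ⟩
      D * deg G v + ∑[ t < n ] send t v  ∎

    balanced-high : ∀ {v} → K ≤ deg G v → ¬ X v → Balanced v
    balanced-high {v} K≤dv ¬x = begin
      target + ∑[ t < n ] send v t       ≤⟨ +-monoʳ-≤ target (sent≤ v) ⟩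
      k * D + b + b * ℓ                  ≡⟨ +-assoc (k * D) b (b * ℓ) ⟩
      k * D + (b + b * ℓ)                ≡⟨ cong (k * D +_) (*-suc b ℓ) ⟨
      k * D + b * suc ℓ                  ≤⟨ affords v K≤dv ¬x ⟩
      D * deg G v                        ≤⟨ m≤m+n _ _ ⟩
      D * deg G v + ∑[ t < n ] send t v  ∎
      where
      ℓ : ℕ
      ℓ = lowNbrs G k v

    balanced : ∀ v → ¬ Exceptional v → Balanced v
    balanced v ¬exc = by-degree (deg G v ≤? k) (K ≤? deg G v)
      where
      by-degree : Dec (deg G v ≤ k) → Dec (K ≤ deg G v) → Balanced v
      by-degree (yes dv≤k) _ = balanced-low dv≤k (≮⇒≥ (¬exc ∘ inj₁)) heavy
        where
        heavy : HasNbrOfDeg≥ G K v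
        heavy = decidable-stable (HasNbrOfDeg≥? G K v) (λ ¬heavy → ¬exc (inj₂ (inj₁ (dv≤k , ¬heavy))))
      by-degree (no dv≰k) (no K≰dv) = balanced-mid (≰⇒> dv≰k) (≰⇒> K≰dv)
      by-degree (no _) (yes K≤dv) = balanced-high K≤dv (¬exc ∘ inj₂ ∘ inj₂)

    discharge : n * target ≤ D * (2 * edgeCount G) + target * count Exceptional?
    discharge = begin
      n * target                                              ≤⟨ discharging (λ v → D * deg G v) send target
                                                                             Exceptional? out≤ balanced ⟩
      ∑[ v < n ] (D * deg G v) + target * count Exceptional?  ≡⟨ cong (_+ target * count Exceptional?)
                                                                     (∑-degree G D) ⟩
      D * (2 * edgeCount G) + target * count Exceptional?     ∎
      where
      out≤ : ∀ v → ∑[ t < n ] send v t ≤ D * deg G v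
      out≤ v = ≤-trans (sent≤ v) (*-mono-≤ b≤D (lowNbrs≤deg G v))

  chargeBound : IsClique G (Small G k) → IsClique G (Starved G k K) → count X? ≤ 1 →
                ChargeBound n (edgeCount G) k D b
  chargeBound small starved X≤1 = ≤-trans discharge (+-monoʳ-≤ _ (*-monoʳ-≤ target exceptional≤))
    where
    exceptional≤ : count Exceptional? ≤ suc k + (suc k + 1)
    exceptional≤ = ≤-trans (count-⊎ {P? = Small? G k})
      (+-mono-≤ (clique-count {G = G} {S? = Small? G k} small <⇒≤)
                (≤-trans (count-⊎ {P? = Starved? G k K})
                         (+-mono-≤ (clique-count {G = G} {S? = Starved? G k K} starved proj₁) X≤1)))

-- Arithmetic of the charges

charge-≤ : ∀ {k a b D d ℓ} → a + b ≡ D → ℓ ≤ d → k * D + b ≤ a * d → k * D + b * suc ℓ ≤ D * d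
charge-≤ {k} {a} {b} {d = d} {ℓ} refl ℓ≤d k*D+b≤a*d = begin
  k * (a + b) + b * suc ℓ      ≡⟨ cong (k * (a + b) +_) (*-suc b ℓ) ⟩
  k * (a + b) + (b + b * ℓ)    ≡⟨ +-assoc (k * (a + b)) b (b * ℓ) ⟨
  k * (a + b) + b + b * ℓ      ≤⟨ +-mono-≤ k*D+b≤a*d (*-monoʳ-≤ b ℓ≤d) ⟩
  a * d + b * d                ≡⟨ *-distribʳ-+ d a b ⟨
  (a + b) * d                  ∎
  where open ≤-Reasoning

charge-< : ∀ {k a b D d ℓ} → a + b ≡ D → ℓ < d → k * D ≤ a * d → k * D + b * suc ℓ ≤ D * d
charge-< {k} {a} {b} {d = d} {ℓ} refl ℓ<d k*D≤a*d = begin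
  k * (a + b) + b * suc ℓ      ≤⟨ +-mono-≤ k*D≤a*d (*-monoʳ-≤ b ℓ<d) ⟩
  a * d + b * d                ≡⟨ *-distribʳ-+ d a b ⟨
  (a + b) * d                  ∎
  where open ≤-Reasoning

m*[1+n]+[n∸m]≡[1+m]*n : ∀ {m n} → m ≤ n → m * suc n + (n ∸ m) ≡ suc m * n
m*[1+n]+[n∸m]≡[1+m]*n {m} m≤n with m≤n⇒∃[o]m+o≡n m≤n
... | o , refl = trans (cong (m * suc (m + o) +_) (m+n∸m≡n m o)) (identity m o)
  where
  identity : ∀ m o → m * suc (m + o) + o ≡ suc m * (m + o)
  identity = solve-∀

charge-suc : ∀ {k K d ℓ} → k ≤ K → K ≤ d → ℓ ≤ d → k * suc K + (K ∸ k) * suc ℓ ≤ suc K * d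
charge-suc {k} {K} k≤K K≤d ℓ≤d =
  charge-≤ {k} {suc k} {K ∸ k} (cong suc (m+[n∸m]≡n k≤K)) ℓ≤d
           (≤-trans (≤-reflexive (m*[1+n]+[n∸m]≡[1+m]*n k≤K)) (*-monoʳ-≤ (suc k) K≤d))

charge-tight : ∀ {k K d ℓ} → k ≤ K → K ≤ d → ℓ < d → k * K + (K ∸ k) * suc ℓ ≤ K * d
charge-tight {k} {K} k≤K K≤d ℓ<d = charge-< {k} {k} {K ∸ k} (m+[n∸m]≡n k≤K) ℓ<d (*-monoʳ-≤ k K≤d)

near⇒ : ∀ {k K K′} → k ≤ K′ → (k + 1) * K′ ≤ (k + 1) * K + (K′ ∸ k) → k * suc K′ ≤ suc k * K
near⇒ {k} {K} k≤K′ near with m≤n⇒∃[o]m+o≡n k≤K′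
... | s′ , refl rewrite m+n∸m≡n k s′ = +-cancelʳ-≤ s′ _ _ (subst₂ _≤_ (lhs k s′) (rhs k K s′) near)
  where
  lhs : ∀ k s′ → (k + 1) * (k + s′) ≡ k * suc (k + s′) + s′
  lhs = solve-∀
  rhs : ∀ k K s′ → (k + 1) * K + s′ ≡ suc k * K + s′
  rhs = solve-∀

far⇒ : ∀ {k K K′} → k ≤ K → k ≤ K′ → (k + 1) * K + (K′ ∸ k) < (k + 1) * K′ → k * K + (K ∸ k) ≤ k * K′
far⇒ {k} k≤K k≤K′ far with m≤n⇒∃[o]m+o≡n k≤K | m≤n⇒∃[o]m+o≡n k≤K′
... | s , refl | s′ , refl rewrite m+n∸m≡n k s | m+n∸m≡n k s′ =
  <⇒≤ (+-cancelʳ-< (k + s′) _ _ (subst₂ _<_ (lhs k s s′) (rhs k s′) far))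
  where
  lhs : ∀ k s s′ → (k + 1) * (k + s) + s′ ≡ k * (k + s) + s + (k + s′)
  lhs = solve-∀
  rhs : ∀ k s′ → (k + 1) * (k + s′) ≡ k * (k + s′) + (k + s′)
  rhs = solve-∀

-- The charge bounds in a saturated graph

module _ {m n} (H : Graph m) (G : Graph n) (sat : Saturated H G) where

  noCopyThrough⇒clique : ∀ {S : Pred (Fin n) 0ℓ} → (∀ {x y} → S x → S y → ¬ CopyThrough H G x y) → IsClique G S
  noCopyThrough⇒clique no-copy {x} {y} sx sy x≢y =
    decidable-stable (IsEdge? G x y) (no-copy sx sy ∘ copyThrough sat x≢y)

  small-clique : IsClique G (Small G (k0 H))
  small-clique = noCopyThrough⇒clique λ dx<k0 dy<k0 c → <⇒≱ (⊔-lub dx<k0 dy<k0) (copy-k0≤ c)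

  starved-clique : 0 < k1′ H → IsClique G (Starved G (k0 H) (k1′ H))
  starved-clique 0<k1′ = noCopyThrough⇒clique no-copy
    where
    no-copy : ∀ {x y} → Starved G (k0 H) (k1′ H) x → Starved G (k0 H) (k1′ H) y → ¬ CopyThrough H G x y
    no-copy (dx≤k0 , ¬heavy-x) (dy≤k0 , ¬heavy-y) c =
      [ ¬heavy-x , ¬heavy-y ]′ (copy-heavyNbr c 0<k1′ (k1′≤wt1 H edge wt0≡k0))
      where
      open CopyThrough c
      wt0≡k0 : wt0 H (u , v) ≡ k0 H
      wt0≡k0 = ≤-antisym (≤-trans wt0≤ (⊔-lub dx≤k0 dy≤k0)) (k0≤wt0 H edge)

  light-clique : 0 < k1 H → IsClique G (λ v → ¬ HasNbrOfDeg≥ G (k1 H) v)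
  light-clique 0<k1 = noCopyThrough⇒clique λ ¬heavy-x ¬heavy-y c →
    [ ¬heavy-x , ¬heavy-y ]′ (copy-heavyNbr c 0<k1 (k1≤wt1 H (CopyThrough.edge c)))

  light-small-clique : IsClique G (λ v → ¬ HasNbrOfDeg≥ G (suc (k1 H)) v × deg G v < k0′ H)
  light-small-clique = noCopyThrough⇒clique no-copy
    where
    no-copy : ∀ {x y} → ¬ HasNbrOfDeg≥ G (suc (k1 H)) x × deg G x < k0′ H →
              ¬ HasNbrOfDeg≥ G (suc (k1 H)) y × deg G y < k0′ H → ¬ CopyThrough H G x y
    no-copy (¬heavy-x , dx<k0′) (¬heavy-y , dy<k0′) c =
      <⇒≱ (⊔-lub dx<k0′ dy<k0′) (≤-trans (k0′≤wt0 H edge wt1≡k1) wt0≤)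
      where
      open CopyThrough c
      wt1≡k1 : wt1 H (u , v) ≡ k1 H
      wt1≡k1 = ≤-antisym (copy-wt1≤ c [ ¬HasNbrOfDeg≥⇒deg≤ {G = G} ¬heavy-x
                                       , ¬HasNbrOfDeg≥⇒deg≤ {G = G} ¬heavy-y ]′)
                         (k1≤wt1 H edge)

  chargeBound-general : ChargeBound n (edgeCount G) (k0 H) (suc (k1′ H)) (k1′ H ∸ k0 H)
  chargeBound-general with k1′ H ≤? k0 H
  ... | yes k1′≤k0 = subst (ChargeBound n (edgeCount G) (k0 H) (suc (k1′ H))) (sym (m≤n⇒m∸n≡0 k1′≤k0))
                           (chargeBound-small G (suc (k1′ H)) small-clique)
  ... | no k1′≰k0 = chargeBound G k0<k1′ (≤-trans (m∸n≤m (k1′ H) (k0 H)) (n≤1+n _)) ∅?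
                                (λ v k1′≤dv _ → charge-suc (<⇒≤ k0<k1′) k1′≤dv (lowNbrs≤deg G v))
                                small-clique (starved-clique (≤-trans z<s k0<k1′))
                                (≤-trans (≤-reflexive (count-none (λ _ ()))) z≤n)
    where
    k0<k1′ : k0 H < k1′ H
    k0<k1′ = ≰⇒> k1′≰k0

  chargeBound-k0<k1 : HasEdge H → k0 H < k1 H → ChargeBound n (edgeCount G) (k0 H) (k1′ H) (k1′ H ∸ k0 H)
  chargeBound-k0<k1 has-edge k0<k1 =
    chargeBound G k0<k1′ (m∸n≤m (k1′ H) (k0 H)) (StarCentre? G (k0 H) (k1′ H)) affords
                small-clique (starved-clique (≤-trans z<s k0<k1′))
                (clique-independent-count {G = G} centres-clique (starCentre-independent {G = G} k0<k1′))
    where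
    k0<k1′ : k0 H < k1′ H
    k0<k1′ = <-≤-trans k0<k1 (k1≤k1′ H has-edge)
    centres-clique : IsClique G (StarCentre G (k0 H) (k1′ H))
    centres-clique (_ , ¬heavy-x) (_ , ¬heavy-y) = light-clique (≤-trans z<s k0<k1)
      (¬heavy-x ∘ HasNbrOfDeg≥-mono {G = G} k0<k1) (¬heavy-y ∘ HasNbrOfDeg≥-mono {G = G} k0<k1)
    affords : ∀ v → k1′ H ≤ deg G v → ¬ StarCentre G (k0 H) (k1′ H) v → Affords G (k0 H) (k1′ H) (k1′ H ∸ k0 H) v
    affords v k1′≤dv ¬centre = charge-tight (<⇒≤ k0<k1′) k1′≤dv (lowNbrs<deg G heavy)
      where
      heavy : HasNbrOfDeg≥ G (suc (k0 H)) v
      heavy = decidable-stable (HasNbrOfDeg≥? G (suc (k0 H)) v) (λ ¬heavy → ¬centre (k1′≤dv , ¬heavy))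

  module _ (k0≡k1 : k0 H ≡ k1 H) (k1<k1′ : k1 H < k1′ H) (k1′<k0′ : k1′ H < k0′ H) where

    private
      k0<k1′ : k0 H < k1′ H
      k0<k1′ = subst (_< k1′ H) (sym k0≡k1) k1<k1′

      k0≤k0′ : k0 H ≤ k0′ H
      k0≤k0′ = <⇒≤ (<-trans k0<k1′ k1′<k0′)

      ShortCentre : Pred (Fin n) 0ℓ
      ShortCentre v = StarCentre G (k0 H) (k1′ H) v × deg G v < k0′ H

      ShortCentre? : Decidable ShortCentre
      ShortCentre? v = StarCentre? G (k0 H) (k1′ H) v ×-dec (deg G v <? k0′ H)

      shortCentres≤1 : count ShortCentre? ≤ 1
      shortCentres≤1 = clique-independent-count {G = G} clique independent
        where
        light : ∀ {x} → ¬ HasNbrOfDeg≥ G (suc (k0 H)) x → ¬ HasNbrOfDeg≥ G (suc (k1 H)) x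
        light {x} = subst (λ k → ¬ HasNbrOfDeg≥ G (suc k) x) k0≡k1
        clique : IsClique G ShortCentre
        clique ((_ , ¬heavy-x) , dx<k0′) ((_ , ¬heavy-y) , dy<k0′) =
          light-small-clique (light ¬heavy-x , dx<k0′) (light ¬heavy-y , dy<k0′)
        independent : IsIndependent G ShortCentre
        independent (centre-x , _) (centre-y , _) = starCentre-independent {G = G} k0<k1′ centre-x centre-y

      high-cases : ∀ {v} → k1′ H ≤ deg G v → ¬ ShortCentre v → HasNbrOfDeg≥ G (suc (k0 H)) v ⊎ k0′ H ≤ deg G v
      high-cases {v} k1′≤dv ¬short with HasNbrOfDeg≥? G (suc (k0 H)) v
      ... | yes heavy = inj₁ heavy
      ... | no ¬heavy = inj₂ (≮⇒≥ (λ dv<k0′ → ¬short ((k1′≤dv , ¬heavy) , dv<k0′)))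

    chargeBound-near : (k0 H + 1) * k0′ H ≤ (k0 H + 1) * k1′ H + (k0′ H ∸ k0 H) →
                       ChargeBound n (edgeCount G) (k0 H) (suc (k0′ H)) (k0′ H ∸ k0 H)
    chargeBound-near near =
      chargeBound G k0<k1′ (≤-trans (m∸n≤m (k0′ H) (k0 H)) (n≤1+n _)) ShortCentre? affords
                  small-clique (starved-clique (≤-trans z<s k0<k1′)) shortCentres≤1
      where
      affords : ∀ v → k1′ H ≤ deg G v → ¬ ShortCentre v → Affords G (k0 H) (suc (k0′ H)) (k0′ H ∸ k0 H) v
      affords v k1′≤dv ¬short with high-cases k1′≤dv ¬short
      ... | inj₁ heavy = charge-< {k0 H} {suc (k0 H)} {k0′ H ∸ k0 H} (cong suc (m+[n∸m]≡n k0≤k0′))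
                                  (lowNbrs<deg G heavy)
                                  (≤-trans (near⇒ k0≤k0′ near) (*-monoʳ-≤ (suc (k0 H)) k1′≤dv))
      ... | inj₂ k0′≤dv = charge-suc k0≤k0′ k0′≤dv (lowNbrs≤deg G v)

    chargeBound-far : ¬ ((k0 H + 1) * k0′ H ≤ (k0 H + 1) * k1′ H + (k0′ H ∸ k0 H)) →
                      ChargeBound n (edgeCount G) (k0 H) (k1′ H) (k1′ H ∸ k0 H)
    chargeBound-far far =
      chargeBound G k0<k1′ (m∸n≤m (k1′ H) (k0 H)) ShortCentre? affords
                  small-clique (starved-clique (≤-trans z<s k0<k1′)) shortCentres≤1
      where
      affords : ∀ v → k1′ H ≤ deg G v → ¬ ShortCentre v → Affords G (k0 H) (k1′ H) (k1′ H ∸ k0 H) v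
      affords v k1′≤dv ¬short with high-cases k1′≤dv ¬short
      ... | inj₁ heavy = charge-tight (<⇒≤ k0<k1′) k1′≤dv (lowNbrs<deg G heavy)
      ... | inj₂ k0′≤dv = charge-≤ {k0 H} {k0 H} {k1′ H ∸ k0 H} (m+[n∸m]≡n (<⇒≤ k0<k1′)) (lowNbrs≤deg G v)
                                   (≤-trans (far⇒ (<⇒≤ k0<k1′) k0≤k0′ (≰⇒> far)) (*-monoʳ-≤ (k0 H) k0′≤dv))

-- From a charge bound to LowerBound

open import Data.Integer using (+_; _-_; +≤+) renaming (_*_ to _*ℤ_; _+_ to _+ℤ_; _≤_ to _≤ℤ_)
import Data.Integer.Properties as ℤₚ

+m-+n≤+[m∸n] : ∀ m n → + m - + n ≤ℤ + (m ∸ n)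
+m-+n≤+[m∸n] m n with n ≤? m
... | yes n≤m = ℤₚ.≤-reflexive (trans (ℤₚ.m-n≡m⊖n m n) (ℤₚ.⊖-≥ n≤m))
... | no n≰m = subst (_≤ℤ + (m ∸ n)) (sym (trans (ℤₚ.m-n≡m⊖n m n) (ℤₚ.⊖-< (≰⇒> n≰m)))) ℤₚ.neg-≤-pos

LowerBound-from-ℕ : ∀ {k K D n e c} → (k * D + (K ∸ k)) * n ≤ 2 * D * (e + c) →
                    LowerBound (+ k) (+ K - + k) D n e c
LowerBound-from-ℕ {k} {K} {D} {n} h =
  ℤₚ.≤-trans (ℤₚ.*-monoʳ-≤-nonNeg (+ n) (ℤₚ.+-monoʳ-≤ (+ k *ℤ + D) (+m-+n≤+[m∸n] K k)))
             (ℤₚ.≤-trans (ℤₚ.≤-reflexive cast) (+≤+ h))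
  where
  cast : (+ k *ℤ + D +ℤ + (K ∸ k)) *ℤ + n ≡ + ((k * D + (K ∸ k)) * n)
  cast = begin
    (+ k *ℤ + D +ℤ + (K ∸ k)) *ℤ + n   ≡⟨ cong (λ z → (z +ℤ + (K ∸ k)) *ℤ + n) (ℤₚ.pos-* k D) ⟨
    (+ (k * D) +ℤ + (K ∸ k)) *ℤ + n    ≡⟨ cong (_*ℤ + n) (ℤₚ.pos-+ (k * D) (K ∸ k)) ⟨
    + (k * D + (K ∸ k)) *ℤ + n         ≡⟨ ℤₚ.pos-* (k * D + (K ∸ k)) n ⟨
    + ((k * D + (K ∸ k)) * n)          ∎
    where open ≡-Reasoning

lowerBound : ∀ {n e k D K Dmax} → ChargeBound n e k D (K ∸ k) → 0 < D → K ≤ D → D ≤ Dmax →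
             LowerBound (+ k) (+ K - + k) D n e (suc k * Dmax * (suc k + (suc k + 1)))
lowerBound {n} {e} {k} {D} {K} {Dmax} bound 0<D K≤D D≤Dmax = LowerBound-from-ℕ {k} {K} {D} {n} {e} {c} (begin
  target * n                    ≡⟨ *-comm target n ⟩
  n * target                    ≤⟨ bound ⟩
  D * (2 * e) + target * X      ≤⟨ +-monoʳ-≤ (D * (2 * e)) (≤-trans (*-monoˡ-≤ X target≤) c≤2Dc) ⟩
  D * (2 * e) + 2 * D * c       ≡⟨ distrib D e c ⟩
  2 * D * (e + c)               ∎)
  where
  open ≤-Reasoning
  X c target : ℕ
  X = suc k + (suc k + 1)
  c = suc k * Dmax * X
  target = k * D + (K ∸ k)
  target≤ : target ≤ suc k * Dmax
  target≤ = begin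
    k * D + (K ∸ k)     ≤⟨ +-mono-≤ (*-monoʳ-≤ k D≤Dmax) (≤-trans (m∸n≤m K k) (≤-trans K≤D D≤Dmax)) ⟩
    k * Dmax + Dmax     ≡⟨ +-comm (k * Dmax) Dmax ⟩
    suc k * Dmax        ∎
  c≤2Dc : c ≤ 2 * D * c
  c≤2Dc = ≤-trans (≤-reflexive (sym (*-identityˡ c))) (*-monoˡ-≤ c (≤-trans 0<D (m≤m+n D (D + 0))))
  distrib : ∀ D e c → D * (2 * e) + 2 * D * c ≡ 2 * D * (e + c)
  distrib = solve-∀

theorem1p2 : ∀ {m} (H : Graph m) → HasEdge H → NoIsolatedEdges H →
    ∃[ c ]
      ((∀ n → m ≤ n → (G : Graph n) → Saturated H G →
          LowerBound (+ k0 H) (+ k1′ H - + k0 H) (suc (k1′ H)) n (edgeCount G) c)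
      × (k0 H < k1 H → ∀ n → m ≤ n → (G : Graph n) → Saturated H G →
          LowerBound (+ k0 H) (+ k1′ H - + k0 H) (k1′ H) n (edgeCount G) c)
      × (k0 H ≡ k1 H → k1 H < k1′ H → k1′ H < k0′ H →
          ∀ n → m ≤ n → (G : Graph n) → Saturated H G →
            ((k0 H + 1) * k0′ H ≤ (k0 H + 1) * k1′ H + (k0′ H ∸ k0 H) →
               LowerBound (+ k0 H) (+ k0′ H - + k0 H) (suc (k0′ H)) n (edgeCount G) c)
            × (¬ ((k0 H + 1) * k0′ H ≤ (k0 H + 1) * k1′ H + (k0′ H ∸ k0 H)) →
               LowerBound (+ k0 H) (+ k1′ H - + k0 H) (k1′ H) n (edgeCount G) c)))
theorem1p2 H has-edge _ =
  constant
  , (λ n _ G sat → lowerBound {Dmax = Dmax} (chargeBound-general H G sat) z<s (n≤1+n _) 1+k1′≤Dmax)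
  , (λ k0<k1 n _ G sat → lowerBound {Dmax = Dmax} (chargeBound-k0<k1 H G sat has-edge k0<k1)
                                     (<-≤-trans (≤-<-trans z≤n k0<k1) (k1≤k1′ H has-edge)) ≤-refl k1′≤Dmax)
  , (λ k0≡k1 k1<k1′ k1′<k0′ n _ G sat →
       (λ near → lowerBound {Dmax = Dmax} (chargeBound-near H G sat k0≡k1 k1<k1′ k1′<k0′ near)
                            z<s (n≤1+n _) 1+k0′≤Dmax)
     , (λ far → lowerBound {Dmax = Dmax} (chargeBound-far H G sat k0≡k1 k1<k1′ k1′<k0′ far)
                           (≤-<-trans z≤n k1<k1′) ≤-refl k1′≤Dmax))
  where
  Dmax constant : ℕ
  Dmax = suc (k1′ H + k0′ H)
  constant = suc (k0 H) * Dmax * (suc (k0 H) + (suc (k0 H) + 1))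
  1+k1′≤Dmax : suc (k1′ H) ≤ Dmax
  1+k1′≤Dmax = s≤s (m≤m+n _ _)
  k1′≤Dmax : k1′ H ≤ Dmax
  k1′≤Dmax = ≤-trans (n≤1+n _) 1+k1′≤Dmax
  1+k0′≤Dmax : suc (k0′ H) ≤ Dmax
  1+k0′≤Dmax = s≤s (m≤n+m _ _)
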